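{- For all $e\geq 0$ and all $n$ with $0\leq n\leq 2^e$: (i) $s(2^{e+1}+n)=s(2^e+n)+s(n)$; (ii) $t(2^{e+1}+n)+t(2^e+n)=(-1)^{e+1}s(n)$.
   Context: The Stern sequence $s$ is defined by $s(0)=0$, $s(1)=1$, $s(2n)=s(n)$, $s(2n+1)=s(n)+s(n+1)$ for $n\geq1$. The twisted Stern sequence $t$ is defined by $t(0)=0$, $t(1)=1$, $t(2n)=-t(n)$, $t(2n+1)=-t(n)-t(n+1)$ for $n\geq 1$. -}

module Defs where

open import Data.Nat using (ℕ; zero; suc; _+_; _*_)
open import Data.Nat.DivMod using (_/_; _%_)
open import Data.Integer using (ℤ; +_; -_) renaming (_+_ to _+ℤ_)

-- Stern sequence and twisted Stern sequence, computed with a fuel argument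
-- (fuel ≥ n suffices since n/2 < n for n ≥ 2).
-- sF k n follows the recurrences:
--   s(0)=0, s(1)=1, s(2m)=s(m), s(2m+1)=s(m)+s(m+1)  (m ≥ 1)
sF : ℕ → ℕ → ℕ
sF _ zero = 0
sF _ (suc zero) = 1
sF zero (suc (suc _)) = 0 -- unreachable when fuel ≥ n
sF (suc k) n@(suc (suc _)) with n % 2
... | zero = sF k (n / 2)
... | suc _ = sF k (n / 2) + sF k (suc (n / 2))

s : ℕ → ℕ
s n = sF n n

tF : ℕ → ℕ → ℤ
tF _ zero = + 0
tF _ (suc zero) = + 1
tF zero (suc (suc _)) = + 0 -- unreachable when fuel ≥ n
tF (suc k) n@(suc (suc _)) with n % 2
... | zero = - tF k (n / 2)
... | suc _ = (- tF k (n / 2)) +ℤ (- tF k (suc (n / 2)))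

t : ℕ → ℤ
t n = tF n n

-- With A = 2^e and n ≤ 2A, the numbers 4A + n and 2A + n have the parity of n, and the
-- recurrences express s and t there through their values at 2A + k and A + k for
-- k ∈ {⌊n/2⌋, ⌈n/2⌉}, where k ≤ A.  Hence both identities at 2A follow from those at A;
-- the sign alternates because t is negated at each halving.
module Submission where

open import Defs
open import Data.Nat using (ℕ; zero; suc; _+_; _^_; _≤_; _<_; z≤n; s≤s; NonZero)
open import Data.Nat.Properties
  using (+-suc; +-identityʳ; ≤-refl; ≤-trans; n≤1+n; m≤m+n; +-commutativeSemigroup;
         ⌊n/2⌋-mono; ⌈n/2⌉-mono; n≡⌊n+n/2⌋; n≡⌈n+n/2⌉)
open import Data.Nat.DivMod using (_/_; _%_; m/n≡1+[m∸n]/n)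
open import Data.Integer using (ℤ; +_; -_) renaming (_+_ to _+ℤ_; _*_ to _*ℤ_; _^_ to _^ℤ_)
open import Data.Integer.Properties using (neg-distrib-+; neg-distribˡ-*; pos-+; -1*i≡-i; *-distribˡ-+)
  renaming (+-commutativeSemigroup to +ℤ-commutativeSemigroup)
open import Algebra.Properties.CommutativeSemigroup +-commutativeSemigroup using (interchange)
open import Algebra.Properties.CommutativeSemigroup +ℤ-commutativeSemigroup
  using () renaming (interchange to ℤ-interchange)
open import Data.Product using (_×_; _,_)
open import Relation.Binary.PropositionalEquality
  using (_≡_; refl; sym; trans; cong; cong₂; subst; subst₂; module ≡-Reasoning)

open ≡-Reasoning

[2+n]/2≡1+n/2 : ∀ n → (2 + n) / 2 ≡ suc (n / 2)
[2+n]/2≡1+n/2 n = m/n≡1+[m∸n]/n {2 + n} (s≤s (s≤s z≤n))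

[n+n]/2≡n : ∀ n → (n + n) / 2 ≡ n
[n+n]/2≡n zero    = refl
[n+n]/2≡n (suc n) = begin
  (suc n + suc n) / 2 ≡⟨ cong (λ j → suc j / 2) (+-suc n n) ⟩
  (2 + (n + n)) / 2   ≡⟨ [2+n]/2≡1+n/2 (n + n) ⟩
  suc ((n + n) / 2)   ≡⟨ cong suc ([n+n]/2≡n n) ⟩
  suc n               ∎

[1+n+n]/2≡n : ∀ n → suc (n + n) / 2 ≡ n
[1+n+n]/2≡n zero    = refl
[1+n+n]/2≡n (suc n) = begin
  suc (suc n + suc n) / 2 ≡⟨ cong (λ j → (2 + j) / 2) (+-suc n n) ⟩
  (3 + (n + n)) / 2       ≡⟨ [2+n]/2≡1+n/2 (suc (n + n)) ⟩
  suc (suc (n + n) / 2)   ≡⟨ cong suc ([1+n+n]/2≡n n) ⟩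
  suc n                   ∎

[2+n+n]/2≡1+n : ∀ n → (2 + (n + n)) / 2 ≡ suc n
[2+n+n]/2≡1+n n = trans ([2+n]/2≡1+n/2 (n + n)) (cong suc ([n+n]/2≡n n))

[3+n+n]/2≡1+n : ∀ n → (3 + (n + n)) / 2 ≡ suc n
[3+n+n]/2≡1+n n = trans ([2+n]/2≡1+n/2 (suc (n + n))) (cong suc ([1+n+n]/2≡n n))

[n+n]%2≡0 : ∀ n → (n + n) % 2 ≡ 0
[n+n]%2≡0 zero    = refl
[n+n]%2≡0 (suc n) = trans (cong (λ k → suc k % 2) (+-suc n n)) ([n+n]%2≡0 n)

[1+n+n]%2≡1 : ∀ n → suc (n + n) % 2 ≡ 1
[1+n+n]%2≡1 zero    = refl
[1+n+n]%2≡1 (suc n) = trans (cong (λ k → (2 + k) % 2) (+-suc n n)) ([1+n+n]%2≡1 n)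

m+m≤n+n⇒m≤n : ∀ {m n} → m + m ≤ n + n → m ≤ n
m+m≤n+n⇒m≤n {m} {n} le =
  subst₂ _≤_ (sym (n≡⌊n+n/2⌋ m)) (sym (n≡⌊n+n/2⌋ n)) (⌊n/2⌋-mono le)

m+m<n+n⇒m<n : ∀ {m n} → m + m < n + n → m < n
m+m<n+n⇒m<n {m} {n} lt =
  subst₂ _≤_ (cong suc (sym (n≡⌊n+n/2⌋ m))) (sym (n≡⌈n+n/2⌉ n)) (⌈n/2⌉-mono lt)

[m+m]+suc[n+n]≡suc[[m+n]+[m+n]] : ∀ m n → (m + m) + suc (n + n) ≡ suc ((m + n) + (m + n))
[m+m]+suc[n+n]≡suc[[m+n]+[m+n]] m n = trans (+-suc (m + m) (n + n)) (cong suc (interchange m m n n))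

neg-[i*j+i*k]≡-i*[j+k] : ∀ i j k → - ((i *ℤ j) +ℤ (i *ℤ k)) ≡ (- i) *ℤ (j +ℤ k)
neg-[i*j+i*k]≡-i*[j+k] i j k = trans (cong -_ (sym (*-distribˡ-+ i j k))) (neg-distribˡ-* i (j +ℤ k))

data Halving : ℕ → Set where
  even : ∀ m → Halving (m + m)
  odd  : ∀ m → Halving (suc (m + m))

data RecursionCase : ℕ → Set where
  case-0    : RecursionCase 0
  case-1    : RecursionCase 1
  case-even : ∀ m → RecursionCase (2 + (m + m))
  case-odd  : ∀ m → RecursionCase (3 + (m + m))

recursionCase : ∀ n → RecursionCase n
recursionCase zero          = case-0
recursionCase (suc zero)    = case-1
recursionCase (suc (suc n)) with recursionCase n
... | case-0      = case-even 0
... | case-1      = case-odd 0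
... | case-even m = subst RecursionCase (cong (λ j → 3 + j) (+-suc m m)) (case-even (suc m))
... | case-odd m  = subst RecursionCase (cong (λ j → 4 + j) (+-suc m m)) (case-odd (suc m))

halving : ∀ n → Halving n
halving n with recursionCase n
... | case-0      = even 0
... | case-1      = odd 0
... | case-even m = subst Halving (cong suc (+-suc m m)) (even (suc m))
... | case-odd m  = subst Halving (cong (λ j → 2 + j) (+-suc m m)) (odd (suc m))

sF-even : ∀ k m → sF (suc k) (2 + (m + m)) ≡ sF k (suc m)
sF-even k m with (m + m) % 2 in eq
... | zero  = cong (sF k) ([2+n+n]/2≡1+n m)
... | suc _ with () ← trans (sym eq) ([n+n]%2≡0 m)

sF-odd : ∀ k m → sF (suc k) (3 + (m + m)) ≡ sF k (suc m) + sF k (2 + m)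
sF-odd k m with suc (m + m) % 2 in eq
... | zero  with () ← trans (sym eq) ([1+n+n]%2≡1 m)
... | suc _ = cong (λ h → sF k h + sF k (suc h)) ([3+n+n]/2≡1+n m)

tF-even : ∀ k m → tF (suc k) (2 + (m + m)) ≡ - tF k (suc m)
tF-even k m with (m + m) % 2 in eq
... | zero  = cong (λ h → - tF k h) ([2+n+n]/2≡1+n m)
... | suc _ with () ← trans (sym eq) ([n+n]%2≡0 m)

tF-odd : ∀ k m → tF (suc k) (3 + (m + m)) ≡ (- tF k (suc m)) +ℤ (- tF k (2 + m))
tF-odd k m with suc (m + m) % 2 in eq
... | zero  with () ← trans (sym eq) ([1+n+n]%2≡1 m)
... | suc _ = cong (λ h → (- tF k h) +ℤ (- tF k (suc h))) ([3+n+n]/2≡1+n m)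

sF-fuel : ∀ {k k′} n → n ≤ k → n ≤ k′ → sF k n ≡ sF k′ n
sF-fuel n _ _ with recursionCase n
sF-fuel _ _ _ | case-0 = refl
sF-fuel _ _ _ | case-1 = refl
sF-fuel {suc k} {suc k′} _ (s≤s le) (s≤s le′) | case-even m = begin
  sF (suc k) (2 + (m + m))  ≡⟨ sF-even k m ⟩
  sF k (suc m)              ≡⟨ sF-fuel (suc m) 1+m≤k 1+m≤k′ ⟩
  sF k′ (suc m)             ≡⟨ sF-even k′ m ⟨
  sF (suc k′) (2 + (m + m)) ∎
  where 1+m≤k  = ≤-trans (s≤s (m≤m+n m m)) le
        1+m≤k′ = ≤-trans (s≤s (m≤m+n m m)) le′
sF-fuel {suc k} {suc k′} _ (s≤s le) (s≤s le′) | case-odd m = begin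
  sF (suc k) (3 + (m + m))      ≡⟨ sF-odd k m ⟩
  sF k (suc m) + sF k (2 + m)   ≡⟨ cong₂ _+_ (sF-fuel (suc m) 1+m≤k 1+m≤k′) (sF-fuel (2 + m) 2+m≤k 2+m≤k′) ⟩
  sF k′ (suc m) + sF k′ (2 + m) ≡⟨ sF-odd k′ m ⟨
  sF (suc k′) (3 + (m + m))     ∎
  where 2+m≤k  = ≤-trans (s≤s (s≤s (m≤m+n m m))) le
        2+m≤k′ = ≤-trans (s≤s (s≤s (m≤m+n m m))) le′
        1+m≤k  = ≤-trans (n≤1+n _) 2+m≤k
        1+m≤k′ = ≤-trans (n≤1+n _) 2+m≤k′

tF-fuel : ∀ {k k′} n → n ≤ k → n ≤ k′ → tF k n ≡ tF k′ n
tF-fuel n _ _ with recursionCase n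
tF-fuel _ _ _ | case-0 = refl
tF-fuel _ _ _ | case-1 = refl
tF-fuel {suc k} {suc k′} _ (s≤s le) (s≤s le′) | case-even m = begin
  tF (suc k) (2 + (m + m))  ≡⟨ tF-even k m ⟩
  - tF k (suc m)            ≡⟨ cong -_ (tF-fuel (suc m) 1+m≤k 1+m≤k′) ⟩
  - tF k′ (suc m)           ≡⟨ tF-even k′ m ⟨
  tF (suc k′) (2 + (m + m)) ∎
  where 1+m≤k  = ≤-trans (s≤s (m≤m+n m m)) le
        1+m≤k′ = ≤-trans (s≤s (m≤m+n m m)) le′
tF-fuel {suc k} {suc k′} _ (s≤s le) (s≤s le′) | case-odd m = begin
  tF (suc k) (3 + (m + m))               ≡⟨ tF-odd k m ⟩
  (- tF k (suc m)) +ℤ (- tF k (2 + m))   ≡⟨ cong₂ (λ u v → (- u) +ℤ (- v))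
                                              (tF-fuel (suc m) 1+m≤k 1+m≤k′)
                                              (tF-fuel (2 + m) 2+m≤k 2+m≤k′) ⟩
  (- tF k′ (suc m)) +ℤ (- tF k′ (2 + m)) ≡⟨ tF-odd k′ m ⟨
  tF (suc k′) (3 + (m + m))              ∎
  where 2+m≤k  = ≤-trans (s≤s (s≤s (m≤m+n m m))) le
        2+m≤k′ = ≤-trans (s≤s (s≤s (m≤m+n m m))) le′
        1+m≤k  = ≤-trans (n≤1+n _) 2+m≤k
        1+m≤k′ = ≤-trans (n≤1+n _) 2+m≤k′

s-even : ∀ m → s (m + m) ≡ s m
s-even zero    = refl
s-even (suc m) = begin
  s (suc m + suc m)           ≡⟨ cong (λ j → s (suc j)) (+-suc m m) ⟩
  sF (2 + (m + m)) (2 + (m + m)) ≡⟨ sF-even (suc (m + m)) m ⟩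
  sF (suc (m + m)) (suc m)    ≡⟨ sF-fuel (suc m) (s≤s (m≤m+n m m)) ≤-refl ⟩
  s (suc m)                   ∎

s-odd : ∀ m → s (suc (m + m)) ≡ s m + s (suc m)
s-odd zero    = refl
s-odd (suc m) = begin
  s (suc (suc m + suc m))                         ≡⟨ cong (λ j → s (2 + j)) (+-suc m m) ⟩
  sF (3 + (m + m)) (3 + (m + m))                  ≡⟨ sF-odd (2 + (m + m)) m ⟩
  sF (2 + (m + m)) (suc m) + sF (2 + (m + m)) (2 + m)
    ≡⟨ cong₂ _+_ (sF-fuel (suc m) (s≤s (≤-trans (m≤m+n m m) (n≤1+n _))) ≤-refl)
                 (sF-fuel (2 + m) (s≤s (s≤s (m≤m+n m m))) ≤-refl) ⟩
  s (suc m) + s (2 + m)                           ∎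

t-even : ∀ m → t (m + m) ≡ - t m
t-even zero    = refl
t-even (suc m) = begin
  t (suc m + suc m)              ≡⟨ cong (λ j → t (suc j)) (+-suc m m) ⟩
  tF (2 + (m + m)) (2 + (m + m)) ≡⟨ tF-even (suc (m + m)) m ⟩
  - tF (suc (m + m)) (suc m)     ≡⟨ cong -_ (tF-fuel (suc m) (s≤s (m≤m+n m m)) ≤-refl) ⟩
  - t (suc m)                    ∎

-- Unlike s, the recurrence for t fails at m = 0: t 1 = 1, but - t 0 - t 1 = -1.
t-odd : ∀ m .{{_ : NonZero m}} → t (suc (m + m)) ≡ (- t m) +ℤ (- t (suc m))
t-odd (suc m) = begin
  t (suc (suc m + suc m))                               ≡⟨ cong (λ j → t (2 + j)) (+-suc m m) ⟩
  tF (3 + (m + m)) (3 + (m + m))                        ≡⟨ tF-odd (2 + (m + m)) m ⟩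
  (- tF (2 + (m + m)) (suc m)) +ℤ (- tF (2 + (m + m)) (2 + m))
    ≡⟨ cong₂ (λ u v → (- u) +ℤ (- v))
             (tF-fuel (suc m) (s≤s (≤-trans (m≤m+n m m) (n≤1+n _))) ≤-refl)
             (tF-fuel (2 + m) (s≤s (s≤s (m≤m+n m m))) ≤-refl) ⟩
  (- t (suc m)) +ℤ (- t (2 + m))                        ∎

t-odd-sum : ∀ i j .{{_ : NonZero i}} .{{_ : NonZero j}} →
  t (suc (i + i)) +ℤ t (suc (j + j)) ≡ - ((t i +ℤ t j) +ℤ (t (suc i) +ℤ t (suc j)))
t-odd-sum i j = begin
  t (suc (i + i)) +ℤ t (suc (j + j))
    ≡⟨ cong₂ _+ℤ_ (t-odd i) (t-odd j) ⟩
  ((- t i) +ℤ (- t (suc i))) +ℤ ((- t j) +ℤ (- t (suc j)))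
    ≡⟨ ℤ-interchange (- t i) (- t (suc i)) (- t j) (- t (suc j)) ⟩
  ((- t i) +ℤ (- t j)) +ℤ ((- t (suc i)) +ℤ (- t (suc j)))
    ≡⟨ cong₂ _+ℤ_ (neg-distrib-+ (t i) (t j)) (neg-distrib-+ (t (suc i)) (t (suc j))) ⟨
  (- (t i +ℤ t j)) +ℤ (- (t (suc i) +ℤ t (suc j)))
    ≡⟨ neg-distrib-+ (t i +ℤ t j) (t (suc i) +ℤ t (suc j)) ⟨
  - ((t i +ℤ t j) +ℤ (t (suc i) +ℤ t (suc j)))
    ∎

SternShift : ℕ → Set
SternShift a = ∀ n → n ≤ a → s ((a + a) + n) ≡ s (a + n) + s n

TwistedShift : ℤ → ℕ → Set
TwistedShift σ a = ∀ n → n ≤ a → t ((a + a) + n) +ℤ t (a + n) ≡ σ *ℤ (+ s n)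

sternShift-double : ∀ {a} → SternShift a → SternShift (a + a)
sternShift-double {a} shift n le with halving n
... | even m = begin
  s (((a + a) + (a + a)) + (m + m))     ≡⟨ cong s (interchange (a + a) (a + a) m m) ⟩
  s (((a + a) + m) + ((a + a) + m))     ≡⟨ s-even ((a + a) + m) ⟩
  s ((a + a) + m)                       ≡⟨ shift m (m+m≤n+n⇒m≤n le) ⟩
  s (a + m) + s m                       ≡⟨ cong₂ _+_ (s-even (a + m)) (s-even m) ⟨
  s ((a + m) + (a + m)) + s (m + m)     ≡⟨ cong (λ j → s j + s (m + m)) (interchange a a m m) ⟨
  s ((a + a) + (m + m)) + s (m + m)     ∎
... | odd m = begin
  s (((a + a) + (a + a)) + suc (m + m))
    ≡⟨ cong s ([m+m]+suc[n+n]≡suc[[m+n]+[m+n]] (a + a) m) ⟩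
  s (suc (((a + a) + m) + ((a + a) + m)))
    ≡⟨ s-odd ((a + a) + m) ⟩
  s ((a + a) + m) + s (suc ((a + a) + m))
    ≡⟨ cong (λ j → s ((a + a) + m) + s j) (+-suc (a + a) m) ⟨
  s ((a + a) + m) + s ((a + a) + suc m)
    ≡⟨ cong₂ _+_ (shift m (≤-trans (n≤1+n m) m<a)) (shift (suc m) m<a) ⟩
  (s (a + m) + s m) + (s (a + suc m) + s (suc m))
    ≡⟨ interchange (s (a + m)) (s m) (s (a + suc m)) (s (suc m)) ⟩
  (s (a + m) + s (a + suc m)) + (s m + s (suc m))
    ≡⟨ cong (λ j → (s (a + m) + s j) + (s m + s (suc m))) (+-suc a m) ⟩
  (s (a + m) + s (suc (a + m))) + (s m + s (suc m))
    ≡⟨ cong₂ _+_ (s-odd (a + m)) (s-odd m) ⟨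
  s (suc ((a + m) + (a + m))) + s (suc (m + m))
    ≡⟨ cong (λ j → s j + s (suc (m + m))) ([m+m]+suc[n+n]≡suc[[m+n]+[m+n]] a m) ⟨
  s ((a + a) + suc (m + m)) + s (suc (m + m))
    ∎
  where m<a = m+m<n+n⇒m<n le

twistedShift-double : ∀ {σ a} → TwistedShift σ a → TwistedShift (- σ) (a + a)
twistedShift-double {σ} {a} shift n le with halving n
... | even m = begin
  t (((a + a) + (a + a)) + (m + m)) +ℤ t ((a + a) + (m + m))
    ≡⟨ cong₂ (λ i j → t i +ℤ t j) (interchange (a + a) (a + a) m m) (interchange a a m m) ⟩
  t (((a + a) + m) + ((a + a) + m)) +ℤ t ((a + m) + (a + m))
    ≡⟨ cong₂ _+ℤ_ (t-even ((a + a) + m)) (t-even (a + m)) ⟩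
  (- t ((a + a) + m)) +ℤ (- t (a + m))    ≡⟨ neg-distrib-+ (t ((a + a) + m)) (t (a + m)) ⟨
  - (t ((a + a) + m) +ℤ t (a + m))        ≡⟨ cong -_ (shift m (m+m≤n+n⇒m≤n le)) ⟩
  - (σ *ℤ (+ s m))                        ≡⟨ neg-distribˡ-* σ (+ s m) ⟩
  (- σ) *ℤ (+ s m)                        ≡⟨ cong (λ j → (- σ) *ℤ (+ j)) (s-even m) ⟨
  (- σ) *ℤ (+ s (m + m))                  ∎
twistedShift-double {σ} {suc a} shift _ le | odd m = begin
  t (((A + A) + (A + A)) + suc (m + m)) +ℤ t ((A + A) + suc (m + m))
    ≡⟨ cong₂ (λ i j → t i +ℤ t j) ([m+m]+suc[n+n]≡suc[[m+n]+[m+n]] (A + A) m)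
                                  ([m+m]+suc[n+n]≡suc[[m+n]+[m+n]] A m) ⟩
  t (suc (((A + A) + m) + ((A + A) + m))) +ℤ t (suc ((A + m) + (A + m)))
    ≡⟨ t-odd-sum ((A + A) + m) (A + m) ⟩
  - ((t ((A + A) + m) +ℤ t (A + m)) +ℤ (t (suc ((A + A) + m)) +ℤ t (suc (A + m))))
    ≡⟨ cong₂ (λ i j → - ((t ((A + A) + m) +ℤ t (A + m)) +ℤ (t i +ℤ t j))) (+-suc (A + A) m) (+-suc A m) ⟨
  - ((t ((A + A) + m) +ℤ t (A + m)) +ℤ (t ((A + A) + suc m) +ℤ t (A + suc m)))
    ≡⟨ cong₂ (λ i j → - (i +ℤ j)) (shift m (≤-trans (n≤1+n m) m<A)) (shift (suc m) m<A) ⟩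
  - ((σ *ℤ (+ s m)) +ℤ (σ *ℤ (+ s (suc m))))
    ≡⟨ neg-[i*j+i*k]≡-i*[j+k] σ (+ s m) (+ s (suc m)) ⟩
  (- σ) *ℤ ((+ s m) +ℤ (+ s (suc m)))           ≡⟨ cong ((- σ) *ℤ_) (pos-+ (s m) (s (suc m))) ⟨
  (- σ) *ℤ (+ (s m + s (suc m)))                ≡⟨ cong (λ j → (- σ) *ℤ (+ j)) (s-odd m) ⟨
  (- σ) *ℤ (+ s (suc (m + m)))                  ∎
  where A = suc a
        m<A = m+m<n+n⇒m<n le

2^[1+e]≡2^e+2^e : ∀ e → 2 ^ suc e ≡ 2 ^ e + 2 ^ e
2^[1+e]≡2^e+2^e e = cong (λ j → 2 ^ e + j) (+-identityʳ (2 ^ e))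

sternShift-2^ : ∀ e → SternShift (2 ^ e)
sternShift-2^ zero    _ z≤n       = refl
sternShift-2^ zero    _ (s≤s z≤n) = refl
sternShift-2^ (suc e) = subst SternShift (sym (2^[1+e]≡2^e+2^e e)) (sternShift-double (sternShift-2^ e))

twistedShift-2^ : ∀ e → TwistedShift ((- + 1) ^ℤ suc e) (2 ^ e)
twistedShift-2^ zero    _ z≤n       = refl
twistedShift-2^ zero    _ (s≤s z≤n) = refl
twistedShift-2^ (suc e) =
  subst₂ TwistedShift (sym (-1*i≡-i ((- + 1) ^ℤ suc e))) (sym (2^[1+e]≡2^e+2^e e))
         (twistedShift-double {σ = (- + 1) ^ℤ suc e} (twistedShift-2^ e))

mainTheorem10 : (e n : ℕ) → n ≤ 2 ^ e →
    (s (2 ^ suc e + n) ≡ s (2 ^ e + n) + s n)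
    × (t (2 ^ suc e + n) +ℤ t (2 ^ e + n) ≡ ((- + 1) ^ℤ suc e) *ℤ (+ s n))
mainTheorem10 e n le rewrite 2^[1+e]≡2^e+2^e e = sternShift-2^ e n le , twistedShift-2^ e n le
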